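{- Let $A$ be a game, $\sigma$ a strategy on $A$, and $\mathsf x_A$ a complete symmetry class of $A$ with chosen canonical representative $\hat{\mathsf x}_A$. For every $+$-covered configuration $x^\sigma$ of $\sigma$ with a positive symmetry $\theta^+:\partial_\sigma(x^\sigma)\cong^+_A\hat{\mathsf x}_A$, and every negative symmetry $\varphi^-:\hat{\mathsf x}_A\cong^-_A\hat{\mathsf x}_A$, there are a unique $+$-covered configuration $y^\sigma$ of $\sigma$, a unique positive symmetry $\psi^+:\partial_\sigma(y^\sigma)\cong^+_A\hat{\mathsf x}_A$ and a unique symmetry $\phi:x^\sigma\cong_\sigma y^\sigma$ such that $\varphi^-\circ\theta^+=\psi^+\circ\partial_\sigma\phi$.
   Context: Event structures: countable set of events, partial order $\le$ with finite down-sets, irreflexive symmetric conflict $\#$ with $e_1\#e_2\le e_2'\Rightarrow e_1\#e_2'$; configurations are finite down-closed conflict-free sets ($\mathscr C(E)$); $\rightarrow$ is immediate causality. An isomorphism family $\tilde E$: bijections between configurations, containing identities, closed under composition and inverse, each with a unique restriction to any sub-configuration of its domain and some extension to any configuration containing its domain; $\theta:x\cong_Ey$. A tcg $A$: such a structure with symmetry-preserved polarity $\mathrm{pol}_A:|A|\to\{ -,+\}$ and subfamilies $\tilde A_+,\tilde A_-$ (positive/negative symmetries, $\cong^\pm_A$) meeting only in identities, each closed within $\tilde A$ under extension by pairs of events of its own polarity. A game adds a symmetry-invariant payoff $\kappa_A:\mathscr C(A)\to\{ -1,0,+1\}$ (payoff $0$: complete) and a chosen canonical representative $\hat{\mathsf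 x}\in\mathsf x$ of each complete symmetry class $\mathsf x$, where $x$ is canonical if each $\theta:x\cong_Ax$ factors uniquely as $\theta^+\circ\theta^-$ with $\theta^-:x\cong^-_Ax$, $\theta^+:x\cong^+_Ax$. A strategy on a game $A$ is an event structure with symmetry $(\sigma,\tilde\sigma)$ with display $\partial_\sigma:|\sigma|\to|A|$ mapping configurations to configurations, injective on configurations, mapping symmetries to symmetries ($\partial_\sigma\theta$ denotes the image symmetry), and: ($\sim$-receptive) for $\theta:x\cong_\sigma y$, $x\cup\{s_1\}\in\mathscr C(\sigma)$ with $s_1$ negative and $\partial\theta\cup\{(\partial s_1,a_2)\}\in\tilde A$ there is a unique $s_2$ with $\theta\cup\{(s_1,s_2)\}\in\tilde\sigma$, $\partial s_2=a_2$; (thin) for $\theta:x\cong_\sigma y$ and $x\cup\{s_1\}\in\mathscr C(\sigma)$ with $s_1$ positive there is a unique $s_2$ with $y\cup\{s_2\}\in\mathscr C(\sigma)$ and $\theta\cup\{(s_1,s_2)\}\in\tilde\sigma$; minimal events negative; (courteous) $s_1\rightarrow s_2$ with $s_1$ positive or $s_2$ negative implies $\partial s_1\rightarrow\partial s_2$; (receptive) for $x\in\mathscr C(\sigma)$ and negative $a\notin\partial x$ with $\partial x\cup\{a\}\in\mathscr C(A)$ there is a unique $s$ with $x\cup\{s\}\in\mathscr C(\sigma)$, $\partial s=a$. Events have the polarity of their display; a configuration is $+$-covered if its maximal events are positive. -}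

module Defs where

open import Level using (0ℓ)
open import Data.Nat using (ℕ)
open import Data.List using (List)
open import Data.List.Membership.Propositional using (_∈_)
open import Data.Product using (Σ; Σ-syntax; ∃; _×_; _,_; proj₁; proj₂)
open import Data.Sum using (_⊎_; inj₁; inj₂)
open import Relation.Nullary using (¬_)
open import Relation.Binary.PropositionalEquality using (_≡_; _≢_)
open import Function.Definitions using (Injective)

Subset : Set → Set₁
Subset E = E → Set

infix 4 _⊆ₛ_ _≐_
_⊆ₛ_ : {E : Set} → Subset E → Subset E → Set
X ⊆ₛ Y = ∀ e → X e → Y e

_≐_ : {E : Set} → Subset E → Subset E → Set
X ≐ Y = (X ⊆ₛ Y) × (Y ⊆ₛ X)

_∪｛_｝ : {E : Set} → Subset E → E → Subset E
(X ∪｛ e ｝) e' = X e' ⊎ e' ≡ e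

Finite : {E : Set} → Subset E → Set
Finite {E} X = Σ (List E) λ l → ∀ e → (X e → e ∈ l) × (e ∈ l → X e)

Rel : Set → Set₁
Rel E = Subset (E × E)

dom : {E : Set} → Rel E → Subset E
dom θ a = Σ _ λ b → θ (a , b)

cod : {E : Set} → Rel E → Subset E
cod θ b = Σ _ λ a → θ (a , b)

-- relational composition:  (θ' ∘ᵣ θ) means "first θ, then θ'"
_∘ᵣ_ : {E : Set} → Rel E → Rel E → Rel E
(θ' ∘ᵣ θ) (a , c) = Σ _ λ b → θ (a , b) × θ' (b , c)

inv : {E : Set} → Rel E → Rel E
inv θ (a , b) = θ (b , a)

idRel : {E : Set} → Subset E → Rel E
idRel x (a , b) = x a × a ≡ b

IsBijection : {E : Set} → Rel E → Set
IsBijection θ =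
  (∀ a b b' → θ (a , b) → θ (a , b') → b ≡ b') ×
  (∀ a a' b → θ (a , b) → θ (a' , b) → a ≡ a')

record EventStructure : Set₁ where
  field
    Ev      : Set
    enc     : Ev → ℕ
    enc-inj : Injective _≡_ _≡_ enc
    _≤_     : Ev → Ev → Set
    ≤-refl  : ∀ e → e ≤ e
    ≤-trans : ∀ {e₁ e₂ e₃} → e₁ ≤ e₂ → e₂ ≤ e₃ → e₁ ≤ e₃
    ≤-antisym : ∀ {e₁ e₂} → e₁ ≤ e₂ → e₂ ≤ e₁ → e₁ ≡ e₂
    down-finite : ∀ e → Finite (λ e' → e' ≤ e)
    _#_     : Ev → Ev → Set
    #-irrefl : ∀ e → ¬ (e # e)
    #-sym    : ∀ {e₁ e₂} → e₁ # e₂ → e₂ # e₁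
    #-inh    : ∀ {e₁ e₂ e₂'} → e₁ # e₂ → e₂ ≤ e₂' → e₁ # e₂'

  _<_ : Ev → Ev → Set
  e₁ < e₂ = (e₁ ≤ e₂) × (e₁ ≢ e₂)

  _⋖_ : Ev → Ev → Set
  e₁ ⋖ e₂ = (e₁ < e₂) × ¬ (Σ Ev λ e → (e₁ < e) × (e < e₂))

  IsConfig : Subset Ev → Set
  IsConfig x =
    Finite x ×
    (∀ e e' → x e → e' ≤ e → x e') ×
    (∀ e e' → x e → x e' → ¬ (e # e'))

module _ (E : EventStructure) where
  open EventStructure E

  IsBijBetween : Rel Ev → Subset Ev → Subset Ev → Set
  IsBijBetween θ x y = IsBijection θ × (dom θ ≐ x) × (cod θ ≐ y)

  record IsIsoFamily (S : Rel Ev → Set) : Set₁ where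
    field
      resp     : ∀ {θ θ'} → θ ≐ θ' → S θ → S θ'
      bij      : ∀ {θ} → S θ →
                 IsConfig (dom θ) × IsConfig (cod θ) × IsBijection θ
      identity : ∀ x → IsConfig x → S (idRel x)
      compose  : ∀ {θ θ'} → S θ → S θ' → cod θ ≐ dom θ' → S (θ' ∘ᵣ θ)
      inverse  : ∀ {θ} → S θ → S (inv θ)
      restrict : ∀ {θ} x' → S θ → IsConfig x' → x' ⊆ₛ dom θ →
                 Σ (Rel Ev) λ θ' → (S θ' × θ' ⊆ₛ θ × dom θ' ≐ x') ×
                   (∀ θ'' → S θ'' → θ'' ⊆ₛ θ → dom θ'' ≐ x' → θ'' ≐ θ')
      extend   : ∀ {θ} x' → S θ → IsConfig x' → dom θ ⊆ₛ x' →
                 Σ (Rel Ev) λ θ' → S θ' × θ ⊆ₛ θ' × dom θ' ≐ x'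

record ESS : Set₂ where
  field
    es  : EventStructure
    Sym : Rel (EventStructure.Ev es) → Set
    isIsoFamily : IsIsoFamily es Sym
  open EventStructure es public

  _∶_≅_ : Rel Ev → Subset Ev → Subset Ev → Set
  θ ∶ x ≅ y = Sym θ × (dom θ ≐ x) × (cod θ ≐ y)

data Pol : Set where
  neg pos : Pol

data Payoff : Set where
  -1ₚ 0ₚ +1ₚ : Payoff

record TCG : Set₂ where
  field
    ess  : ESS
  open ESS ess public
  field
    pol      : Ev → Pol
    pol-sym  : ∀ {θ a b} → Sym θ → θ (a , b) → pol a ≡ pol b
    Sym⁺     : Rel Ev → Set
    Sym⁻     : Rel Ev → Set
    Sym⁺-fam : IsIsoFamily es Sym⁺
    Sym⁻-fam : IsIsoFamily es Sym⁻
    Sym⁺⊆Sym : ∀ {θ} → Sym⁺ θ → Sym θ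
    Sym⁻⊆Sym : ∀ {θ} → Sym⁻ θ → Sym θ
    ⁺∩⁻-id   : ∀ {θ} → Sym⁺ θ → Sym⁻ θ → ∀ a b → θ (a , b) → a ≡ b
    Sym⁺-ext : ∀ {θ θ'} → Sym⁺ θ → Sym θ' → θ ⊆ₛ θ' →
               (∀ a b → θ' (a , b) → ¬ θ (a , b) → pol a ≡ pos) → Sym⁺ θ'
    Sym⁻-ext : ∀ {θ θ'} → Sym⁻ θ → Sym θ' → θ ⊆ₛ θ' →
               (∀ a b → θ' (a , b) → ¬ θ (a , b) → pol a ≡ neg) → Sym⁻ θ'

  _∶_≅⁺_ : Rel Ev → Subset Ev → Subset Ev → Set
  θ ∶ x ≅⁺ y = Sym⁺ θ × (dom θ ≐ x) × (cod θ ≐ y)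

  _∶_≅⁻_ : Rel Ev → Subset Ev → Subset Ev → Set
  θ ∶ x ≅⁻ y = Sym⁻ θ × (dom θ ≐ x) × (cod θ ≐ y)

  IsCanonical : Subset Ev → Set₁
  IsCanonical x =
    ∀ θ → θ ∶ x ≅ x →
      Σ (Rel Ev × Rel Ev) λ { (θ⁺ , θ⁻) →
        (θ⁻ ∶ x ≅⁻ x × θ⁺ ∶ x ≅⁺ x × θ ≐ (θ⁺ ∘ᵣ θ⁻)) ×
        (∀ ψ⁺ ψ⁻ → ψ⁻ ∶ x ≅⁻ x → ψ⁺ ∶ x ≅⁺ x → θ ≐ (ψ⁺ ∘ᵣ ψ⁻) →
           (ψ⁺ ≐ θ⁺) × (ψ⁻ ≐ θ⁻)) }

record Game : Set₂ where
  field
    tcg : TCG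
  open TCG tcg public
  field
    κ       : Subset Ev → Payoff
    κ-resp  : ∀ {x y} → x ≐ y → κ x ≡ κ y
    κ-sym   : ∀ {θ} → Sym θ → κ (dom θ) ≡ κ (cod θ)
    -- choice of canonical representative of each complete symmetry class:
    -- canon x is the representative of the class of x
    canon        : Subset Ev → Subset Ev
    canon-config : ∀ x → IsConfig x → κ x ≡ 0ₚ → IsConfig (canon x)
    canon-inclass : ∀ x → IsConfig x → κ x ≡ 0ₚ →
                    Σ (Rel Ev) λ θ → θ ∶ x ≅ canon x
    canon-invariant : ∀ x y θ → IsConfig x → κ x ≡ 0ₚ → θ ∶ x ≅ y →
                      canon x ≐ canon y
    canon-canonical : ∀ x → IsConfig x → κ x ≡ 0ₚ → IsCanonical (canon x)

  Complete : Subset Ev → Set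
  Complete x = κ x ≡ 0ₚ

img : {E F : Set} → (E → F) → Subset E → Subset F
img f x a = Σ _ λ s → x s × f s ≡ a

imgRel : {E F : Set} → (E → F) → Rel E → Rel F
imgRel f θ (a , b) = Σ _ λ s → Σ _ λ s' → θ (s , s') × f s ≡ a × f s' ≡ b

record Strategy (A : Game) : Set₂ where
  module A = Game A
  field
    σ : ESS
  open ESS σ public
  field
    ∂ : Ev → A.Ev
    ∂-config : ∀ x → IsConfig x → A.IsConfig (img ∂ x)
    ∂-inj    : ∀ x → IsConfig x → ∀ s s' → x s → x s' → ∂ s ≡ ∂ s' → s ≡ s'
    ∂-sym    : ∀ θ → Sym θ → A.Sym (imgRel ∂ θ)

  polσ : Ev → Pol
  polσ s = A.pol (∂ s)

  field
    ~-receptive :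
      ∀ θ x y s₁ a₂ → θ ∶ x ≅ y → IsConfig (x ∪｛ s₁ ｝) → ¬ x s₁ →
      polσ s₁ ≡ neg → A.Sym (imgRel ∂ θ ∪｛ (∂ s₁ , a₂) ｝) →
      Σ Ev λ s₂ → (Sym (θ ∪｛ (s₁ , s₂) ｝) × ∂ s₂ ≡ a₂) ×
        (∀ s₂' → Sym (θ ∪｛ (s₁ , s₂') ｝) → ∂ s₂' ≡ a₂ → s₂' ≡ s₂)
    thin :
      ∀ θ x y s₁ → θ ∶ x ≅ y → IsConfig (x ∪｛ s₁ ｝) → ¬ x s₁ →
      polσ s₁ ≡ pos →
      Σ Ev λ s₂ → (IsConfig (y ∪｛ s₂ ｝) × Sym (θ ∪｛ (s₁ , s₂) ｝)) ×
        (∀ s₂' → IsConfig (y ∪｛ s₂' ｝) → Sym (θ ∪｛ (s₁ , s₂') ｝) → s₂' ≡ s₂)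
    minimal-neg : ∀ s → (∀ s' → s' ≤ s → s' ≡ s) → polσ s ≡ neg
    courteous : ∀ s₁ s₂ → s₁ ⋖ s₂ → (polσ s₁ ≡ pos ⊎ polσ s₂ ≡ neg) →
                A._⋖_ (∂ s₁) (∂ s₂)
    receptive :
      ∀ x a → IsConfig x → A.pol a ≡ neg → ¬ img ∂ x a →
      A.IsConfig (img ∂ x ∪｛ a ｝) →
      Σ Ev λ s → (IsConfig (x ∪｛ s ｝) × ∂ s ≡ a) ×
        (∀ s' → IsConfig (x ∪｛ s' ｝) → ∂ s' ≡ a → s' ≡ s)

  +-covered : Subset Ev → Set
  +-covered x = IsConfig x ×
    (∀ s → x s → (∀ s' → x s' → s ≤ s' → s' ≡ s) → polσ s ≡ pos)

-- Existence: build ϕ and ψ⁺ event by event along xσ (removing maximal events), keeping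
-- ψ⁺ ∘ ∂ϕ ⊆ ω, where ω is φ⁻ ∘ θ⁺ restricted to the current configuration. A positive
-- event s is matched by thinness, and ψ⁺ becomes ω ∘ (∂ϕ)⁻¹, whose only new pair starts at
-- the positive ∂ s₂. For a negative s, ψ⁺⁻¹ is first extended positively to the codomain of
-- ω, and s is matched by ~-receptivity against the resulting symmetry.
-- Uniqueness: for two solutions, ϕ' ∘ ϕ⁻¹ is a symmetry of σ whose display ψ⁺'⁻¹ ∘ ψ⁺ is
-- positive; such symmetries are identities, by induction along causality using thinness at
-- positive events and receptivity at negative ones.

module Submission where

open import Defs
open import Data.Product using (Σ; _×_; _,_; proj₁; proj₂)
open import Data.Sum using (inj₁; inj₂)
open import Data.Empty using (⊥-elim)
open import Data.Nat as ℕ using (zero; suc; s≤s)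
import Data.Nat.Properties as ℕ
open import Data.List using ([]; _∷_; length; filter)
open import Data.List.Relation.Unary.Any using (here; there)
import Data.List.Relation.Unary.Any as Any
open import Data.List.Relation.Unary.Any.Properties using (¬Any[])
open import Data.List.Membership.Propositional using (_∈_)
open import Data.List.Membership.Propositional.Properties using (∈-filter⁺; ∈-filter⁻)
open import Data.List.Properties using (filter-notAll)
open import Relation.Nullary using (¬_; Dec; yes; no; ¬?)
open import Relation.Binary.Definitions using (DecidableEquality; Decidable)
open import Relation.Binary.PropositionalEquality using (_≡_; _≢_; refl; sym; trans; cong; subst)

module _ {E : Set} where

  ≐-refl : {X : Subset E} → X ≐ X
  ≐-refl = (λ _ x → x) , (λ _ x → x)

  ≐-sym : {X Y : Subset E} → X ≐ Y → Y ≐ X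
  ≐-sym (X⊆Y , Y⊆X) = Y⊆X , X⊆Y

  ≐-trans : {X Y Z : Subset E} → X ≐ Y → Y ≐ Z → X ≐ Z
  ≐-trans (X⊆Y , Y⊆X) (Y⊆Z , Z⊆Y) = (λ e x → Y⊆Z e (X⊆Y e x)) , (λ e z → Y⊆X e (Z⊆Y e z))

  cod-cong : {θ θ' : Rel E} → θ ≐ θ' → cod θ ≐ cod θ'
  cod-cong (θ⊆θ' , θ'⊆θ) = (λ { b (a , p) → a , θ⊆θ' _ p }) , (λ { b (a , p) → a , θ'⊆θ _ p })

  dom-∘ᵣ : {θ θ' : Rel E} → cod θ ⊆ₛ dom θ' → dom (θ' ∘ᵣ θ) ≐ dom θ
  dom-∘ᵣ cod⊆dom = (λ { a (c , b , p , _) → b , p })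
                 , (λ { a (b , p) → let (c , q) = cod⊆dom b (a , p) in c , b , p , q })

  cod-∘ᵣ : {θ θ' : Rel E} → dom θ' ⊆ₛ cod θ → cod (θ' ∘ᵣ θ) ≐ cod θ'
  cod-∘ᵣ dom⊆cod = (λ { c (a , b , _ , q) → b , q })
                 , (λ { c (b , q) → let (a , p) = dom⊆cod b (c , q) in a , b , p , q })

  dom-idRel : {X : Subset E} → dom (idRel X) ≐ X
  dom-idRel = (λ { a (_ , x , _) → x }) , (λ a x → a , x , refl)

  cod-idRel : {X : Subset E} → cod (idRel X) ≐ X
  cod-idRel = (λ { a (_ , x , refl) → x }) , (λ a x → a , x , refl)

  idRel-∪｛｝ : {X : Subset E} {e : E} → idRel (X ∪｛ e ｝) ≐ (idRel X ∪｛ (e , e) ｝)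
  idRel-∪｛｝ = (λ { _ (inj₁ x , refl) → inj₁ (x , refl) ; _ (inj₂ refl , refl) → inj₂ refl })
             , (λ { _ (inj₁ (x , refl)) → inj₁ x , refl ; _ (inj₂ refl) → inj₂ refl , refl })

  cod-idRel-∪｛｝ : {X : Subset E} {e e' : E} → cod (idRel X ∪｛ (e , e') ｝) ≐ (X ∪｛ e' ｝)
  cod-idRel-∪｛｝ = (λ { _ (_ , inj₁ (x , refl)) → inj₁ x ; _ (_ , inj₂ refl) → inj₂ refl })
                 , (λ { a (inj₁ x) → a , inj₁ (x , refl) ; _ (inj₂ refl) → _ , inj₂ refl })

module _ {E F : Set} (f : E → F) where

  img-cong : {X Y : Subset E} → X ≐ Y → img f X ≐ img f Y
  img-cong (X⊆Y , Y⊆X) = (λ { a (e , x , eq) → e , X⊆Y e x , eq })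
                       , (λ { a (e , y , eq) → e , Y⊆X e y , eq })

  imgRel-mono : {θ θ' : Rel E} → θ ⊆ₛ θ' → imgRel f θ ⊆ₛ imgRel f θ'
  imgRel-mono θ⊆θ' _ (e , e' , p , eq , eq') = e , e' , θ⊆θ' _ p , eq , eq'

  dom-imgRel : {θ : Rel E} → dom (imgRel f θ) ≐ img f (dom θ)
  dom-imgRel = (λ { a (_ , e , e' , p , eq , _) → e , (e' , p) , eq })
             , (λ { a (e , (e' , p) , eq) → f e' , e , e' , p , eq , refl })

  cod-imgRel : {θ : Rel E} → cod (imgRel f θ) ≐ img f (cod θ)
  cod-imgRel = (λ { b (_ , e , e' , p , _ , eq) → e' , (e , p) , eq })
             , (λ { b (e' , (e , p) , eq) → f e , e , e' , p , refl , eq })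

  img-∪｛｝ : {X : Subset E} {e : E} → img f (X ∪｛ e ｝) ≐ (img f X ∪｛ f e ｝)
  img-∪｛｝ = (λ { _ (e , inj₁ x , eq) → inj₁ (e , x , eq) ; _ (_ , inj₂ refl , refl) → inj₂ refl })
           , (λ { _ (inj₁ (e , x , eq)) → e , inj₁ x , eq ; _ (inj₂ refl) → _ , inj₂ refl , refl })

  imgRel-∪｛｝ : {θ : Rel E} {e e' : E} →
                imgRel f (θ ∪｛ (e , e') ｝) ≐ (imgRel f θ ∪｛ (f e , f e') ｝)
  imgRel-∪｛｝ = (λ { _ (e , e' , inj₁ p , eq , eq') → inj₁ (e , e' , p , eq , eq')
                    ; _ (e , e' , inj₂ refl , refl , refl) → inj₂ refl })
               , (λ { _ (inj₁ (e , e' , p , eq , eq')) → e , e' , inj₁ p , eq , eq'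
                    ; _ (inj₂ refl) → _ , _ , inj₂ refl , refl , refl })

module EventStructureProperties (E : EventStructure) where
  open EventStructure E

  _≟_ : DecidableEquality Ev
  a ≟ b with enc a ℕ.≟ enc b
  ... | yes enc-eq = yes (enc-inj enc-eq)
  ... | no enc-neq = no (λ eq → enc-neq (cong enc eq))

  _≤?_ : Decidable _≤_
  a ≤? b with Any.any? (a ≟_) (proj₁ (down-finite b))
  ... | yes a∈ = yes (proj₂ (proj₂ (down-finite b) a) a∈)
  ... | no a∉ = no (λ a≤b → a∉ (proj₁ (proj₂ (down-finite b) a) a≤b))

  IsConfig-resp : {X Y : Subset Ev} → X ≐ Y → IsConfig X → IsConfig Y
  IsConfig-resp (X⊆Y , Y⊆X) ((l , enum) , down-closed , conflict-free) =
    (l , λ e → (λ y → proj₁ (enum e) (Y⊆X e y)) , (λ e∈ → X⊆Y e (proj₂ (enum e) e∈))) ,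
    (λ e e' y e'≤e → X⊆Y e' (down-closed e e' (Y⊆X e y) e'≤e)) ,
    (λ e e' y y' → conflict-free e e' (Y⊆X e y) (Y⊆X e' y'))

  _∖｛_｝ : Subset Ev → Ev → Subset Ev
  (X ∖｛ s ｝) e = X e × e ≢ s

  Maximal : Subset Ev → Ev → Set
  Maximal X s = ∀ e → X e → s ≤ e → e ≡ s

  ↓ : Ev → Subset Ev
  ↓ s e = e ≤ s

  ↓-IsConfig : ∀ s → IsConfig (↓ s)
  ↓-IsConfig s = down-finite s , (λ e e' e≤s e'≤e → ≤-trans e'≤e e≤s) ,
    λ e e' e≤s e'≤s e#e' → #-irrefl s (#-inh (#-sym (#-inh e#e' e'≤s)) e≤s)

  ↓-Maximal : ∀ s → Maximal (↓ s) s
  ↓-Maximal s e e≤s s≤e = ≤-antisym e≤s s≤e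

  ∖-IsConfig : {X : Subset Ev} {s : Ev} → IsConfig X → Maximal X s → IsConfig (X ∖｛ s ｝)
  ∖-IsConfig {s = s} ((l , enum) , down-closed , conflict-free) s-max =
    (filter (λ e → ¬? (e ≟ s)) l ,
      λ e → (λ { (x , e≢s) → ∈-filter⁺ (λ e → ¬? (e ≟ s)) (proj₁ (enum e) x) e≢s })
          , (λ e∈ → let (e∈l , e≢s) = ∈-filter⁻ (λ e → ¬? (e ≟ s)) {xs = l} e∈
                    in proj₂ (enum e) e∈l , e≢s)) ,
    (λ { e e' (x , e≢s) e'≤e → down-closed e e' x e'≤e , λ { refl → e≢s (s-max e x e'≤e) } }) ,
    (λ { e e' (x , _) (x' , _) → conflict-free e e' x x' })

  ∖-∪｛｝ : {X : Subset Ev} {s : Ev} → X s → ((X ∖｛ s ｝) ∪｛ s ｝) ≐ X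
  ∖-∪｛｝ {X} {s} xs = (λ { e (inj₁ (x , _)) → x ; e (inj₂ refl) → xs }) , λ e x → split e x (e ≟ s)
    where
    split : ∀ e → X e → Dec (e ≡ s) → ((X ∖｛ s ｝) ∪｛ s ｝) e
    split e x (yes e≡s) = inj₂ e≡s
    split e x (no e≢s) = inj₁ (x , e≢s)

  maximal-∈ : ∀ h t → Σ Ev λ m → m ∈ h ∷ t × (∀ e → e ∈ h ∷ t → m ≤ e → e ≡ m)
  maximal-∈ h [] = h , here refl , λ { e (here e≡h) _ → e≡h }
  maximal-∈ h (h' ∷ t) with maximal-∈ h' t
  ... | m , m∈ , m-max with m ≤? h
  ...   | yes m≤h = h , here refl , λ
          { e (here e≡h) _ → e≡h
          ; e (there e∈) h≤e → let e≡m = m-max e e∈ (≤-trans m≤h h≤e)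
                               in trans e≡m (≤-antisym m≤h (subst (h ≤_) e≡m h≤e)) }
  ...   | no m≰h = m , there m∈ , λ
          { e (here refl) m≤e → ⊥-elim (m≰h m≤e)
          ; e (there e∈) m≤e → m-max e e∈ m≤e }

  config-ind : ∀ {ℓ} (P : Subset Ev → Set ℓ) →
    (∀ x → IsConfig x → (∀ e → ¬ x e) → P x) →
    (∀ x s → IsConfig x → x s → Maximal x s → P (x ∖｛ s ｝) → P x) →
    ∀ x → IsConfig x → P x
  config-ind P base step x x-config = go _ x x-config ℕ.≤-refl
    where
    go : ∀ n x (x-config : IsConfig x) → length (proj₁ (proj₁ x-config)) ℕ.≤ n → P x
    go _ x x-config@(([] , enum) , _) _ = base x x-config (λ e xe → ¬Any[] (proj₁ (enum e) xe))
    go zero x ((_ ∷ _ , _) , _) ()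
    go (suc n) x x-config@((h ∷ t , enum) , _) (s≤s |t|≤n) with maximal-∈ h t
    ... | m , m∈ , m-max =
      step x m x-config (proj₂ (enum m) m∈) m-max-x
        (go n (x ∖｛ m ｝) (∖-IsConfig x-config m-max-x) shorter)
      where
      m-max-x : Maximal x m
      m-max-x e xe = m-max e (proj₁ (enum e) xe)
      shorter : length (filter (λ e → ¬? (e ≟ m)) (h ∷ t)) ℕ.≤ n
      shorter = ℕ.≤-trans (ℕ.≤-pred (filter-notAll (λ e → ¬? (e ≟ m)) (h ∷ t)
                  (Any.map (λ { refl e≢m → e≢m refl }) m∈))) |t|≤n

module SymmetryProperties (S : ESS) where
  open ESS S
  open IsIsoFamily isIsoFamily
  open EventStructureProperties es

  functional : ∀ {θ} → Sym θ → ∀ {a b b'} → θ (a , b) → θ (a , b') → b ≡ b'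
  functional θ-sym = proj₁ (proj₂ (proj₂ (bij θ-sym))) _ _ _

  injective : ∀ {θ} → Sym θ → ∀ {a a' b} → θ (a , b) → θ (a' , b) → a ≡ a'
  injective θ-sym = proj₂ (proj₂ (proj₂ (bij θ-sym))) _ _ _

  dom-IsConfig : ∀ {θ} → Sym θ → IsConfig (dom θ)
  dom-IsConfig θ-sym = proj₁ (bij θ-sym)

  cod-IsConfig : ∀ {θ} → Sym θ → IsConfig (cod θ)
  cod-IsConfig θ-sym = proj₁ (proj₂ (bij θ-sym))

  ⊆-agrees-on-dom : ∀ {θ θ'} → Sym θ → θ' ⊆ₛ θ → ∀ {a b} → dom θ' a → θ (a , b) → θ' (a , b)
  ⊆-agrees-on-dom {θ' = θ'} θ-sym θ'⊆θ (b' , p') p =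
    subst (λ b → θ' (_ , b)) (functional θ-sym (θ'⊆θ _ p') p) p'

  -- Restrict θ⁻¹ to ↓ t': its codomain is down-closed and contains s', hence s.
  monotone : ∀ {θ s s' t t'} → Sym θ → θ (s , t) → θ (s' , t') → s ≤ s' → t ≤ t'
  monotone {θ} {s} {s'} {t} {t'} θ-sym p p' s≤s'
    with restrict (↓ t') (inverse θ-sym) (↓-IsConfig t')
           (λ e e≤t' → proj₁ (proj₂ (cod-IsConfig θ-sym)) t' e (s' , p') e≤t')
  ... | ρ , (ρ-sym , ρ⊆θ⁻¹ , ρ-dom) , _ = subst (_≤ t') t₁≡t (proj₁ ρ-dom t₁ (s , ρ-t₁s))
    where
    ρ-t's' : ρ (t' , s')
    ρ-t's' = let (u , ρ-t'u) = proj₂ ρ-dom t' (≤-refl t')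
             in subst (λ u → ρ (t' , u)) (injective θ-sym (ρ⊆θ⁻¹ _ ρ-t'u) p') ρ-t'u
    s∈cod-ρ : cod ρ s
    s∈cod-ρ = proj₁ (proj₂ (cod-IsConfig ρ-sym)) s' s (t' , ρ-t's') s≤s'
    t₁ : Ev
    t₁ = proj₁ s∈cod-ρ
    ρ-t₁s : ρ (t₁ , s)
    ρ-t₁s = proj₂ s∈cod-ρ
    t₁≡t : t₁ ≡ t
    t₁≡t = functional θ-sym (ρ⊆θ⁻¹ _ ρ-t₁s) p

  reflects-Maximal : ∀ {θ s t} → Sym θ → θ (s , t) → Maximal (cod θ) t → Maximal (dom θ) s
  reflects-Maximal {θ} θ-sym p t-max s' (t' , p') s≤s' =
    injective θ-sym (subst (λ t'' → θ (s' , t'')) (t-max t' (s' , p') (monotone θ-sym p p' s≤s')) p') p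

module TCGProperties (A : TCG) where
  open TCG A
  open SymmetryProperties ess
  module F⁺ = IsIsoFamily Sym⁺-fam

  Sym⁺-⊆ : ∀ {θ θ'} → Sym⁺ θ → Sym θ' → θ' ⊆ₛ θ → Sym⁺ θ'
  Sym⁺-⊆ {θ} {θ'} θ⁺ θ'-sym θ'⊆θ
    with F⁺.restrict (dom θ') θ⁺ (dom-IsConfig θ'-sym) (λ { a (b , p) → b , θ'⊆θ _ p })
  ... | ρ , (ρ⁺ , ρ⊆θ , ρ-dom) , _ = F⁺.resp (ρ⊆θ' , θ'⊆ρ) ρ⁺
    where
    θ-sym : Sym θ
    θ-sym = Sym⁺⊆Sym θ⁺
    ρ⊆θ' : ρ ⊆ₛ θ'
    ρ⊆θ' (a , b) r = ⊆-agrees-on-dom θ-sym θ'⊆θ (proj₁ ρ-dom a (b , r)) (ρ⊆θ _ r)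
    θ'⊆ρ : θ' ⊆ₛ ρ
    θ'⊆ρ (a , b) p = ⊆-agrees-on-dom θ-sym ρ⊆θ (proj₂ ρ-dom a (b , p)) (θ'⊆θ _ p)

module StrategyProperties (G : Game) (σ : Strategy G) where
  open Strategy σ renaming (σ to σ-ess)
  open EventStructureProperties es
  open SymmetryProperties σ-ess
  open TCGProperties A.tcg using (Sym⁺-⊆)
  module EA = EventStructureProperties A.es
  module SA = SymmetryProperties A.ess
  module Fσ = IsIsoFamily isIsoFamily
  module FA = IsIsoFamily A.isIsoFamily
  module FA⁺ = IsIsoFamily A.Sym⁺-fam
  module FA⁻ = IsIsoFamily A.Sym⁻-fam

  +-covered-≅ : ∀ {ϕ x y} → ϕ ∶ x ≅ y → +-covered x → +-covered y
  +-covered-≅ {ϕ} {x} (ϕ-sym , ϕ-dom , ϕ-cod) (x-config , x-max⁺) =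
    IsConfig-resp ϕ-cod (cod-IsConfig ϕ-sym) , λ t yt t-max →
      let (s , p) = proj₂ ϕ-cod t yt
          t-max' : Maximal (cod ϕ) t
          t-max' t' t'∈ = t-max t' (proj₁ ϕ-cod t' t'∈)
          s-max : Maximal x s
          s-max s' xs' = reflects-Maximal ϕ-sym p t-max' s' (proj₂ ϕ-dom s' xs')
      in trans (sym (A.pol-sym (∂-sym ϕ ϕ-sym) (s , t , p , refl , refl)))
               (x-max⁺ s (proj₁ ϕ-dom s (t , p)) s-max)

  module _ {χ : Rel Ev} (χ-sym : Sym χ) (∂χ⁺ : A.Sym⁺ (imgRel ∂ χ)) where

    Fixed : Ev → Set
    Fixed s = ∀ t → χ (s , t) → s ≡ t

    module FixedStep {s t : Ev} (below : ∀ e → e ≤ s → e ≢ s → Fixed e) (p : χ (s , t)) where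
      D : Subset Ev
      D = ↓ s ∖｛ s ｝

      D-config : IsConfig D
      D-config = ∖-IsConfig (↓-IsConfig s) (↓-Maximal s)

      D∪s-config : IsConfig (D ∪｛ s ｝)
      D∪s-config = IsConfig-resp (≐-sym (∖-∪｛｝ (≤-refl s))) (↓-IsConfig s)

      s∉D : ¬ D s
      s∉D (_ , s≢s) = s≢s refl

      ↓s⊆dom-χ : ↓ s ⊆ₛ dom χ
      ↓s⊆dom-χ e e≤s = proj₁ (proj₂ (dom-IsConfig χ-sym)) s e (t , p) e≤s

      ρ : Rel Ev
      ρ = idRel D ∪｛ (s , t) ｝

      ρ⊆χ : ρ ⊆ₛ χ
      ρ⊆χ _ (inj₁ ((e≤s , e≢s) , refl)) =
        let (e' , χ-ee') = ↓s⊆dom-χ _ e≤s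
        in subst (λ e'' → χ (_ , e'')) (sym (below _ e≤s e≢s e' χ-ee')) χ-ee'
      ρ⊆χ _ (inj₂ refl) = p

      ρ-sym : Sym ρ
      ρ-sym with Fσ.restrict (↓ s) χ-sym (↓-IsConfig s) ↓s⊆dom-χ
      ... | χₛ , (χₛ-sym , χₛ⊆χ , χₛ-dom) , _ = Fσ.resp (χₛ⊆ρ , ρ⊆χₛ) χₛ-sym
        where
        χₛ⊆ρ : χₛ ⊆ₛ ρ
        χₛ⊆ρ (e , e') q with e ≟ s
        ... | yes refl = inj₂ (cong (s ,_) (functional χ-sym (χₛ⊆χ _ q) p))
        ... | no e≢s =
          let e≤s = proj₁ χₛ-dom e (e' , q)
          in inj₁ ((e≤s , e≢s) , below e e≤s e≢s e' (χₛ⊆χ _ q))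
        ρ⊆χₛ : ρ ⊆ₛ χₛ
        ρ⊆χₛ (e , e') r = ⊆-agrees-on-dom χ-sym χₛ⊆χ (proj₂ χₛ-dom e (e≤s r)) (ρ⊆χ _ r)
          where
          e≤s : ρ (e , e') → e ≤ s
          e≤s (inj₁ ((e≤s , _) , _)) = e≤s
          e≤s (inj₂ refl) = ≤-refl s

      D∪t-config : IsConfig (D ∪｛ t ｝)
      D∪t-config = IsConfig-resp cod-idRel-∪｛｝ (cod-IsConfig ρ-sym)

      fixed⁺ : polσ s ≡ pos → s ≡ t
      fixed⁺ s⁺ =
        let (_ , _ , unique) = thin (idRel D) D D s (Fσ.identity D D-config , dom-idRel , cod-idRel)
                                 D∪s-config s∉D s⁺
        in trans (unique s D∪s-config (Fσ.resp idRel-∪｛｝ (Fσ.identity _ D∪s-config)))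
                 (sym (unique t D∪t-config ρ-sym))

      -- ∂ρ is positive as a part of ∂χ, and negative as an extension of the identity by a
      -- negative pair; hence ∂ s ≡ ∂ t, and receptivity identifies s and t.
      fixed⁻ : polσ s ≡ neg → s ≡ t
      fixed⁻ s⁻ =
        let (_ , _ , unique) = receptive D (∂ s) D-config s⁻ ∂s∉∂D
                                 (EA.IsConfig-resp (img-∪｛｝ ∂) (∂-config _ D∪s-config))
        in trans (unique s D∪s-config refl) (sym (unique t D∪t-config (sym ∂s≡∂t)))
        where
        ∂ρ-sym : A.Sym (imgRel ∂ ρ)
        ∂ρ-sym = ∂-sym ρ ρ-sym
        ∂ρ⁺ : A.Sym⁺ (imgRel ∂ ρ)
        ∂ρ⁺ = Sym⁺-⊆ ∂χ⁺ ∂ρ-sym (imgRel-mono ∂ ρ⊆χ)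
        id⊆∂ρ : idRel (img ∂ D) ⊆ₛ imgRel ∂ ρ
        id⊆∂ρ _ ((e , d , refl) , refl) = e , e , inj₁ (d , refl) , refl , refl
        new-negative : ∀ a b → imgRel ∂ ρ (a , b) → ¬ idRel (img ∂ D) (a , b) → A.pol a ≡ neg
        new-negative _ _ (e , _ , inj₁ (d , refl) , refl , refl) ∉id = ⊥-elim (∉id ((e , d , refl) , refl))
        new-negative _ _ (_ , _ , inj₂ refl , refl , refl) _ = s⁻
        ∂ρ⁻ : A.Sym⁻ (imgRel ∂ ρ)
        ∂ρ⁻ = A.Sym⁻-ext (FA⁻.identity (img ∂ D) (∂-config D D-config)) ∂ρ-sym id⊆∂ρ new-negative
        ∂s≡∂t : ∂ s ≡ ∂ t
        ∂s≡∂t = A.⁺∩⁻-id ∂ρ⁺ ∂ρ⁻ _ _ (s , t , inj₂ refl , refl , refl)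
        ∂s∉∂D : ¬ img ∂ D (∂ s)
        ∂s∉∂D (e , (e≤s , e≢s) , ∂e≡∂s) = e≢s (∂-inj (↓ s) (↓-IsConfig s) e s e≤s (≤-refl s) ∂e≡∂s)

      s≡t : s ≡ t
      s≡t with polσ s in pol-s
      ... | pos = fixed⁺ pol-s
      ... | neg = fixed⁻ pol-s

    positive-display⇒identity : ∀ s → Fixed s
    positive-display⇒identity s =
      config-ind (λ x → ∀ e → x e → Fixed e) (λ _ _ empty e xe → ⊥-elim (empty e xe)) step
        (↓ s) (↓-IsConfig s) s (≤-refl s)
      where
      step : ∀ x m → IsConfig x → x m → Maximal x m →
             (∀ e → (x ∖｛ m ｝) e → Fixed e) → ∀ e → x e → Fixed e
      step x m (_ , down-closed , _) _ _ IH e xe with e ≟ m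
      ... | no e≢m = IH e (xe , e≢m)
      ... | yes refl = λ t p → FixedStep.s≡t (λ e' e'≤e e'≢e → IH e' (down-closed e e' xe e'≤e , e'≢e)) p

  ψ∘∂ϕ⇒ψ : ∀ {ϕ ψ s t c} → Sym ϕ → ϕ (s , t) → (ψ ∘ᵣ imgRel ∂ ϕ) (∂ s , c) → ψ (∂ t , c)
  ψ∘∂ϕ⇒ψ {ψ = ψ} {s} {t} {c} ϕ-sym p (b , ∂ϕ-sb , q) =
    subst (λ b → ψ (b , c)) (SA.functional (∂-sym _ ϕ-sym) ∂ϕ-sb (s , t , p , refl , refl)) q

  ∘ᵣ-cancelʳ-⊆ : ∀ {ϕ₁ ϕ₂ ψ₁ ψ₂} → Sym ϕ₂ → dom ψ₁ ⊆ₛ img ∂ (cod ϕ₁) → ϕ₁ ⊆ₛ ϕ₂ →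
                 (ψ₁ ∘ᵣ imgRel ∂ ϕ₁) ⊆ₛ (ψ₂ ∘ᵣ imgRel ∂ ϕ₂) → ψ₁ ⊆ₛ ψ₂
  ∘ᵣ-cancelʳ-⊆ {ψ₂ = ψ₂} ϕ₂-sym ψ₁-dom ϕ₁⊆ϕ₂ ψ₁∘∂ϕ₁⊆ (b , c) q with ψ₁-dom b (c , q)
  ... | t , (s , p) , refl = ψ∘∂ϕ⇒ψ {ψ = ψ₂} ϕ₂-sym (ϕ₁⊆ϕ₂ _ p) (ψ₁∘∂ϕ₁⊆ _ (∂ t , (s , t , p , refl , refl) , q))

  factorisation-unique :
    ∀ {x y y' z ϕ ϕ' ψ ψ'} → ϕ ∶ x ≅ y → A._∶_≅⁺_ ψ (img ∂ y) z →
    ϕ' ∶ x ≅ y' → A._∶_≅⁺_ ψ' (img ∂ y') z →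
    (ψ ∘ᵣ imgRel ∂ ϕ) ≐ (ψ' ∘ᵣ imgRel ∂ ϕ') → (ϕ' ≐ ϕ) × (ψ' ≐ ψ)
  factorisation-unique {ϕ = ϕ} {ϕ'} {ψ} {ψ'} (ϕ-sym , ϕ-dom , ϕ-cod) (ψ⁺ , ψ-dom , ψ-cod)
    (ϕ'-sym , ϕ'-dom , ϕ'-cod) (ψ'⁺ , ψ'-dom , ψ'-cod) (⊆ψ'∘∂ϕ' , ⊆ψ∘∂ϕ) =
    (ϕ'⊆ϕ , ϕ⊆ϕ') ,
    ∘ᵣ-cancelʳ-⊆ ϕ-sym (proj₁ (≐-trans ψ'-dom (img-cong ∂ (≐-sym ϕ'-cod)))) ϕ'⊆ϕ ⊆ψ∘∂ϕ ,
    ∘ᵣ-cancelʳ-⊆ ϕ'-sym (proj₁ (≐-trans ψ-dom (img-cong ∂ (≐-sym ϕ-cod)))) ϕ⊆ϕ' ⊆ψ'∘∂ϕ'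
    where
    χ : Rel Ev
    χ = ϕ' ∘ᵣ inv ϕ
    χ-sym : Sym χ
    χ-sym = Fσ.compose (Fσ.inverse ϕ-sym) ϕ'-sym (≐-trans ϕ-dom (≐-sym ϕ'-dom))

    ψ-total : ∀ {s t} → ϕ (s , t) → Σ A.Ev λ c → ψ (∂ t , c)
    ψ-total {t = t} p = proj₂ ψ-dom (∂ t) (t , proj₁ ϕ-cod t (_ , p) , refl)

    ψ'-from-ψ : ∀ {s t t' c} → ϕ (s , t) → ϕ' (s , t') → ψ (∂ t , c) → ψ' (∂ t' , c)
    ψ'-from-ψ {t = t} p p' q = ψ∘∂ϕ⇒ψ {ψ = ψ'} ϕ'-sym p' (⊆ψ'∘∂ϕ' _ (∂ t , (_ , t , p , refl , refl) , q))

    ∂χ⊆ : imgRel ∂ χ ⊆ₛ (inv ψ' ∘ᵣ ψ)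
    ∂χ⊆ _ (t , t' , (s , p , p') , refl , refl) =
      let (c , q) = ψ-total p in c , q , ψ'-from-ψ p p' q
    ⊆∂χ : (inv ψ' ∘ᵣ ψ) ⊆ₛ imgRel ∂ χ
    ⊆∂χ (a , b) (c , q , q') with proj₁ ψ-dom a (c , q)
    ... | t , t∈y , refl =
      let (s , p) = proj₂ ϕ-cod t t∈y
          (t' , p') = proj₂ ϕ'-dom s (proj₁ ϕ-dom s (t , p))
      in t , t' , (s , p , p') , refl ,
         SA.injective (A.Sym⁺⊆Sym ψ'⁺) (ψ'-from-ψ p p' q) q'

    ∂χ⁺ : A.Sym⁺ (imgRel ∂ χ)
    ∂χ⁺ = FA⁺.resp (⊆∂χ , ∂χ⊆) (FA⁺.compose ψ⁺ (FA⁺.inverse ψ'⁺) (≐-trans ψ-cod (≐-sym ψ'-cod)))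

    ϕ'⊆ϕ : ϕ' ⊆ₛ ϕ
    ϕ'⊆ϕ (s , t') p' =
      let (t , p) = proj₂ ϕ-dom s (proj₁ ϕ'-dom s (t' , p'))
      in subst (λ t → ϕ (s , t)) (positive-display⇒identity χ-sym ∂χ⁺ t t' (s , p , p')) p
    ϕ⊆ϕ' : ϕ ⊆ₛ ϕ'
    ϕ⊆ϕ' (s , t) p =
      let (t' , p') = proj₂ ϕ'-dom s (proj₁ ϕ-dom s (t , p))
      in subst (λ t' → ϕ' (s , t')) (sym (positive-display⇒identity χ-sym ∂χ⁺ t t' (s , p , p'))) p'

  record PositiveFactorisation (ω : Rel A.Ev) (x : Subset Ev) : Set₁ where
    field
      ϕ : Rel Ev
      ψ : Rel A.Ev
      ϕ-sym : Sym ϕ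
      ϕ-dom : dom ϕ ≐ x
      ψ⁺ : A.Sym⁺ ψ
      ψ-dom : dom ψ ≐ img ∂ (cod ϕ)
      ψ∘∂ϕ⊆ω : (ψ ∘ᵣ imgRel ∂ ϕ) ⊆ₛ ω

    ψ∘∂ϕ⇒ω : ∀ {s t c} → ϕ (s , t) → ψ (∂ t , c) → ω (∂ s , c)
    ψ∘∂ϕ⇒ω {t = t} p q = ψ∘∂ϕ⊆ω _ (∂ t , (_ , t , p , refl , refl) , q)

    ω⇒ψ : A.Sym ω → ∀ {s t c} → ϕ (s , t) → ω (∂ s , c) → ψ (∂ t , c)
    ω⇒ψ ω-sym {t = t} {c} p w =
      let (d , q) = proj₂ ψ-dom (∂ t) (t , (_ , p) , refl)
      in subst (λ d → ψ (∂ t , d)) (SA.functional ω-sym (ψ∘∂ϕ⇒ω p q) w) q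

    ω≐ψ∘∂ϕ : A.Sym ω → dom ω ≐ img ∂ x → ω ≐ (ψ ∘ᵣ imgRel ∂ ϕ)
    ω≐ψ∘∂ϕ ω-sym ω-dom = ω⊆ , ψ∘∂ϕ⊆ω
      where
      ω⊆ : ω ⊆ₛ (ψ ∘ᵣ imgRel ∂ ϕ)
      ω⊆ (a , c) w with proj₁ ω-dom a (c , w)
      ... | s , xs , refl =
        let (t , p) = proj₂ ϕ-dom s xs
        in ∂ t , (s , t , p , refl , refl) , ω⇒ψ ω-sym p w

  factorisation-mono : ∀ {ω ω' x} → ω ⊆ₛ ω' → PositiveFactorisation ω x → PositiveFactorisation ω' x
  factorisation-mono ω⊆ω' F = record
    { ϕ = ϕ ; ψ = ψ ; ϕ-sym = ϕ-sym ; ϕ-dom = ϕ-dom ; ψ⁺ = ψ⁺ ; ψ-dom = ψ-dom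
    ; ψ∘∂ϕ⊆ω = λ pair r → ω⊆ω' pair (ψ∘∂ϕ⊆ω pair r) }
    where open PositiveFactorisation F

  empty-factorisation : ∀ {ω x} → IsConfig x → (∀ e → ¬ x e) → PositiveFactorisation ω x
  empty-factorisation {x = x} x-config empty = record
    { ϕ = idRel x
    ; ψ = idRel (img ∂ x)
    ; ϕ-sym = Fσ.identity x x-config
    ; ϕ-dom = dom-idRel
    ; ψ⁺ = FA⁺.identity (img ∂ x) (∂-config x x-config)
    ; ψ-dom = ≐-trans dom-idRel (img-cong ∂ (≐-sym cod-idRel))
    ; ψ∘∂ϕ⊆ω = λ { _ (_ , (s , _ , (xs , _) , _) , _) → ⊥-elim (empty s xs) }
    }

  module Extension {ω : Rel A.Ev} {x : Subset Ev} {s : Ev} (ω-sym : A.Sym ω) (ω-dom : dom ω ≐ img ∂ x)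
                   (x-config : IsConfig x) (xs : x s) (F : PositiveFactorisation ω (x ∖｛ s ｝)) where
    open PositiveFactorisation F

    x⁻ : Subset Ev
    x⁻ = x ∖｛ s ｝

    ϕ-iso : ϕ ∶ x⁻ ≅ cod ϕ
    ϕ-iso = ϕ-sym , ϕ-dom , ≐-refl

    x⁻∪s-config : IsConfig (x⁻ ∪｛ s ｝)
    x⁻∪s-config = IsConfig-resp (≐-sym (∖-∪｛｝ xs)) x-config

    s∉x⁻ : ¬ x⁻ s
    s∉x⁻ (_ , s≢s) = s≢s refl

    ϕ∪-dom : ∀ s₂ → dom (ϕ ∪｛ (s , s₂) ｝) ≐ x
    ϕ∪-dom s₂ = (λ { e (_ , inj₁ p) → proj₁ (proj₁ ϕ-dom e (_ , p)) ; e (_ , inj₂ refl) → xs })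
              , (λ e xe → cases e xe)
      where
      cases : ∀ e → x e → dom (ϕ ∪｛ (s , s₂) ｝) e
      cases e xe with e ≟ s
      ... | yes refl = s₂ , inj₂ refl
      ... | no e≢s = let (t , p) = proj₂ ϕ-dom e (xe , e≢s) in t , inj₁ p

    positive : polσ s ≡ pos → PositiveFactorisation ω x
    positive s⁺ with thin ϕ x⁻ (cod ϕ) s ϕ-iso x⁻∪s-config s∉x⁻ s⁺
    ... | s₂ , (_ , ϕ₁-sym) , _ = record
      { ϕ = ϕ₁
      ; ψ = ψ₁
      ; ϕ-sym = ϕ₁-sym
      ; ϕ-dom = ϕ∪-dom s₂
      ; ψ⁺ = A.Sym⁺-ext ψ⁺ ψ₁-sym ψ⊆ψ₁ ψ₁-new-positive
      ; ψ-dom = ≐-trans (dom-∘ᵣ (proj₁ ∂ϕ₁-dom)) (cod-imgRel ∂)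
      ; ψ∘∂ϕ⊆ω = λ { (_ , c) (_ , ∂ϕ₁-ab , _ , ∂ϕ₁-a'b , w) →
                     subst (λ a → ω (a , c)) (SA.injective ∂ϕ₁-sym ∂ϕ₁-a'b ∂ϕ₁-ab) w }
      }
      where
      ϕ₁ : Rel Ev
      ϕ₁ = ϕ ∪｛ (s , s₂) ｝
      ∂ϕ₁-sym : A.Sym (imgRel ∂ ϕ₁)
      ∂ϕ₁-sym = ∂-sym ϕ₁ ϕ₁-sym
      ∂ϕ₁-dom : dom (imgRel ∂ ϕ₁) ≐ dom ω
      ∂ϕ₁-dom = ≐-trans (dom-imgRel ∂) (≐-trans (img-cong ∂ (ϕ∪-dom s₂)) (≐-sym ω-dom))
      ψ₁ : Rel A.Ev
      ψ₁ = ω ∘ᵣ inv (imgRel ∂ ϕ₁)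
      ψ₁-sym : A.Sym ψ₁
      ψ₁-sym = FA.compose (FA.inverse ∂ϕ₁-sym) ω-sym ∂ϕ₁-dom
      ψ⊆ψ₁ : ψ ⊆ₛ ψ₁
      ψ⊆ψ₁ (b , c) q with proj₁ ψ-dom b (c , q)
      ... | t , (e , p) , refl = ∂ e , (e , t , inj₁ p , refl , refl) , ψ∘∂ϕ⇒ω p q
      ψ₁-new-positive : ∀ b c → ψ₁ (b , c) → ¬ ψ (b , c) → A.pol b ≡ pos
      ψ₁-new-positive _ _ (_ , (_ , _ , inj₁ p , refl , refl) , w) ∉ψ = ⊥-elim (∉ψ (ω⇒ψ ω-sym p w))
      ψ₁-new-positive _ _ (_ , (_ , _ , inj₂ refl , refl , refl) , _) _ =
        trans (sym (A.pol-sym ∂ϕ₁-sym (s , s₂ , inj₂ refl , refl , refl))) s⁺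

    -- a₂ is the image of ∂ s under ω followed by a positive extension of ψ⁻¹.
    negative : polσ s ≡ neg → PositiveFactorisation ω x
    negative s⁻ with FA⁺.extend (cod ω) (FA⁺.inverse ψ⁺) (SA.cod-IsConfig ω-sym) cod-ψ⊆cod-ω
      where
      cod-ψ⊆cod-ω : cod ψ ⊆ₛ cod ω
      cod-ψ⊆cod-ω c (b , q) with proj₁ ψ-dom b (c , q)
      ... | t , (e , p) , refl = ∂ e , ψ∘∂ϕ⇒ω p q
    ... | ρ , ρ⁺ , ψ⁻¹⊆ρ , ρ-dom =
      let (s₂ , (ϕ₁-sym , ∂s₂≡a₂) , _) =
            ~-receptive ϕ x⁻ (cod ϕ) s a₂ ϕ-iso x⁻∪s-config s∉x⁻ s⁻ (FA.resp Γ≐ Γ-sym)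
      in finish s₂ ϕ₁-sym ∂s₂≡a₂
      where
      c : A.Ev
      c = proj₁ (proj₂ ω-dom (∂ s) (s , xs , refl))
      ω-sc : ω (∂ s , c)
      ω-sc = proj₂ (proj₂ ω-dom (∂ s) (s , xs , refl))
      a₂ : A.Ev
      a₂ = proj₁ (proj₂ ρ-dom c (∂ s , ω-sc))
      ρ-ca₂ : ρ (c , a₂)
      ρ-ca₂ = proj₂ (proj₂ ρ-dom c (∂ s , ω-sc))
      ρ-sym : A.Sym ρ
      ρ-sym = A.Sym⁺⊆Sym ρ⁺

      Γ : Rel A.Ev
      Γ = ρ ∘ᵣ ω
      Γ-sym : A.Sym Γ
      Γ-sym = FA.compose ω-sym ρ-sym (≐-sym ρ-dom)
      Γ⊆ : Γ ⊆ₛ (imgRel ∂ ϕ ∪｛ (∂ s , a₂) ｝)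
      Γ⊆ (a , b) (c' , w , r) with proj₁ ω-dom a (c' , w)
      ... | e , xe , refl with e ≟ s
      ...   | yes refl = inj₂ (cong (∂ s ,_)
                (SA.functional ρ-sym (subst (λ d → ρ (d , b)) (SA.functional ω-sym w ω-sc) r) ρ-ca₂))
      ...   | no e≢s = let (t , p) = proj₂ ϕ-dom e (xe , e≢s) in
                inj₁ (e , t , p , refl , SA.functional ρ-sym (ψ⁻¹⊆ρ _ (ω⇒ψ ω-sym p w)) r)
      ⊆Γ : (imgRel ∂ ϕ ∪｛ (∂ s , a₂) ｝) ⊆ₛ Γ
      ⊆Γ _ (inj₁ (e , t , p , refl , refl)) =
        let (d , q) = proj₂ ψ-dom (∂ t) (t , (e , p) , refl) in d , ψ∘∂ϕ⇒ω p q , ψ⁻¹⊆ρ _ q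
      ⊆Γ _ (inj₂ refl) = c , ω-sc , ρ-ca₂
      Γ≐ : Γ ≐ (imgRel ∂ ϕ ∪｛ (∂ s , a₂) ｝)
      Γ≐ = Γ⊆ , ⊆Γ

      finish : ∀ s₂ → Sym (ϕ ∪｛ (s , s₂) ｝) → ∂ s₂ ≡ a₂ → PositiveFactorisation ω x
      finish s₂ ϕ₁-sym ∂s₂≡a₂ = record
        { ϕ = ϕ ∪｛ (s , s₂) ｝
        ; ψ = inv ρ
        ; ϕ-sym = ϕ₁-sym
        ; ϕ-dom = ϕ∪-dom s₂
        ; ψ⁺ = FA⁺.inverse ρ⁺
        ; ψ-dom = ≐-trans (≐-sym (cod-∘ᵣ (proj₁ ρ-dom))) (≐-trans (cod-cong (≐-sym ∂ϕ₁≐Γ)) (cod-imgRel ∂))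
        ; ψ∘∂ϕ⊆ω = λ { (a , c'') (b , ∂ϕ₁-ab , r) →
                       let (c' , w , r') = proj₁ ∂ϕ₁≐Γ _ ∂ϕ₁-ab
                       in subst (λ d → ω (a , d)) (SA.injective ρ-sym r' r) w }
        }
        where
        ∂ϕ₁≐Γ : imgRel ∂ (ϕ ∪｛ (s , s₂) ｝) ≐ Γ
        ∂ϕ₁≐Γ = ≐-trans (imgRel-∪｛｝ ∂)
                  (subst (λ a → (imgRel ∂ ϕ ∪｛ (∂ s , a) ｝) ≐ Γ) (sym ∂s₂≡a₂) (≐-sym Γ≐))

    extend : PositiveFactorisation ω x
    extend with polσ s in pol-s
    ... | pos = positive pol-s
    ... | neg = negative pol-s

  factorise : ∀ x → IsConfig x → ∀ {ω} → A.Sym ω → img ∂ x ⊆ₛ dom ω → PositiveFactorisation ω x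
  factorise = config-ind (λ x → ∀ {ω} → A.Sym ω → img ∂ x ⊆ₛ dom ω → PositiveFactorisation ω x)
                (λ _ x-config empty _ _ → empty-factorisation x-config empty) step
    where
    step : ∀ x s → IsConfig x → x s → Maximal x s →
           (∀ {ω} → A.Sym ω → img ∂ (x ∖｛ s ｝) ⊆ₛ dom ω → PositiveFactorisation ω (x ∖｛ s ｝)) →
           ∀ {ω} → A.Sym ω → img ∂ x ⊆ₛ dom ω → PositiveFactorisation ω x
    step x s x-config xs _ IH ω-sym ∂x⊆dom-ω
      with FA.restrict (img ∂ x) ω-sym (∂-config x x-config) ∂x⊆dom-ω
    ... | ωₓ , (ωₓ-sym , ωₓ⊆ω , ωₓ-dom) , _ =
      factorisation-mono ωₓ⊆ω (Extension.extend ωₓ-sym ωₓ-dom x-config xs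
        (IH ωₓ-sym λ { a (e , (xe , _) , ∂e≡a) → proj₂ ωₓ-dom a (e , xe , ∂e≡a) }))

propositionC1 : (A : Game) (σ : Strategy A) →
    let open Strategy σ in
    (x₀ : Subset A.Ev) → A.IsConfig x₀ → A.Complete x₀ →
    (xσ : Subset Ev) → +-covered xσ →
    (θ⁺ : Rel A.Ev) → A._∶_≅⁺_ θ⁺ (img ∂ xσ) (A.canon x₀) →
    (φ⁻ : Rel A.Ev) → A._∶_≅⁻_ φ⁻ (A.canon x₀) (A.canon x₀) →
    Σ (Subset Ev × Rel A.Ev × Rel Ev) (λ { (yσ , ψ⁺ , ϕ) →
      (+-covered yσ × A._∶_≅⁺_ ψ⁺ (img ∂ yσ) (A.canon x₀) × ϕ ∶ xσ ≅ yσ ×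
       (φ⁻ ∘ᵣ θ⁺) ≐ (ψ⁺ ∘ᵣ imgRel ∂ ϕ)) ×
      ((yσ' : Subset Ev) (ψ⁺' : Rel A.Ev) (ϕ' : Rel Ev) →
        +-covered yσ' → A._∶_≅⁺_ ψ⁺' (img ∂ yσ') (A.canon x₀) → ϕ' ∶ xσ ≅ yσ' →
        (φ⁻ ∘ᵣ θ⁺) ≐ (ψ⁺' ∘ᵣ imgRel ∂ ϕ') →
        (yσ' ≐ yσ) × (ψ⁺' ≐ ψ⁺) × (ϕ' ≐ ϕ)) })
propositionC1 A σ x₀ _ _ xσ xσ-covered θ⁺ (θ⁺-sym , θ⁺-dom , θ⁺-cod) φ⁻ (φ⁻-sym , φ⁻-dom , φ⁻-cod) =
  (cod ϕ , ψ , ϕ) , (+-covered-≅ ϕ-iso xσ-covered , ψ-iso , ϕ-iso , ω≐) ,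
  λ yσ' ψ' ϕ' _ ψ'-iso ϕ'-iso ω≐' →
    let (ϕ'≐ϕ , ψ'≐ψ) = factorisation-unique ϕ-iso ψ-iso ϕ'-iso ψ'-iso (≐-trans (≐-sym ω≐) ω≐')
    in ≐-trans (≐-sym (proj₂ (proj₂ ϕ'-iso))) (cod-cong ϕ'≐ϕ) , ψ'≐ψ , ϕ'≐ϕ
  where
  open StrategyProperties A σ
  open Strategy σ using (∂; module A; _∶_≅_)

  ω : Rel A.Ev
  ω = φ⁻ ∘ᵣ θ⁺
  ω-sym : A.Sym ω
  ω-sym = FA.compose (A.Sym⁺⊆Sym θ⁺-sym) (A.Sym⁻⊆Sym φ⁻-sym) (≐-trans θ⁺-cod (≐-sym φ⁻-dom))
  ω-dom : dom ω ≐ img ∂ xσ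
  ω-dom = ≐-trans (dom-∘ᵣ (proj₁ (≐-trans θ⁺-cod (≐-sym φ⁻-dom)))) θ⁺-dom
  ω-cod : cod ω ≐ A.canon x₀
  ω-cod = ≐-trans (cod-∘ᵣ (proj₁ (≐-trans φ⁻-dom (≐-sym θ⁺-cod)))) φ⁻-cod

  open PositiveFactorisation (factorise xσ (proj₁ xσ-covered) ω-sym (proj₂ ω-dom))

  ω≐ : ω ≐ (ψ ∘ᵣ imgRel ∂ ϕ)
  ω≐ = ω≐ψ∘∂ϕ ω-sym ω-dom
  ϕ-iso : ϕ ∶ xσ ≅ cod ϕ
  ϕ-iso = ϕ-sym , ϕ-dom , ≐-refl
  ψ-iso : A._∶_≅⁺_ ψ (img ∂ (cod ϕ)) (A.canon x₀)
  ψ-iso = ψ⁺ , ψ-dom ,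
    ≐-trans (≐-sym (cod-∘ᵣ (λ b b∈ → proj₂ (cod-imgRel ∂) b (proj₁ ψ-dom b b∈))))
            (≐-trans (cod-cong (≐-sym ω≐)) ω-cod)
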